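{- Let $\ell\ge 7$, let $G$ be a maximal $\mathcal{C}_{<\ell}$-free plane graph, and let $C$ be a facial cycle of $G$. Let $x,y$ be antipodal vertices of $C$ and $z$ be a center of a segment of $C$ with endpoints $x$ and $y$. Let $C'$ be a $C$-convex $(x,y; \ell)$-lens. If $z \in V(C')$, then $\|C\|\leq 8\ell- 13$.
   Context: $\mathcal{C}_{<\ell}$ denotes the family of cycles of length less than $\ell$. A maximal $\mathcal{C}_{<\ell}$-free plane graph is a plane graph with no cycle of length less than $\ell$ such that adding any new edge between its vertices creates either a crossing or a cycle of length less than $\ell$. $\|C\|$ is the number of edges of $C$. Two vertices of $C$ are antipodal if their distance on $C$ is $\lfloor \|C\|/2\rfloor$. Segments of a cycle are its proper connected subgraphs; an ear of $C$ is a path with at least two vertices whose endpoints lie on $C$ and no other vertex or edge lies on $C$. An $x,y$-path $P$ is $C$-convex if either it is a segment of $C$, or for some vertices $x',y'$ on $P$, $xPx'$ and $y'Py$ are segments of $C$ (possibly trivial) and $x'Py'$ is an ear of $C$. A cycle $C'$ of length at most $2\ell-2$ containing $x,y$ is an $(x,y;\ell)$-lens; it is $C$-convex if $x$ and $y$ split $C'$ into two edge-disjoint $x,y$-paths that are both $C$-convex. -}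

module Defs where

open import Data.Nat using (ℕ; zero; suc; _+_; _*_; _∸_; _≤_; _<_; _/_)
open import Data.Nat.Properties using (_≤?_)
open import Data.Fin using (Fin; toℕ)
open import Data.Fin.Properties using (all?)
open import Data.List using (List; length; filter; allFin)
open import Data.Product using (Σ; ∃; ∃-syntax; _×_; _,_)
open import Data.Sum using (_⊎_)
open import Relation.Binary.PropositionalEquality using (_≡_; _≢_)
open import Relation.Nullary using (¬_)

iter : {A : Set} → (A → A) → ℕ → A → A
iter f zero    a = a
iter f (suc k) a = f (iter f k a)

-- Plane graphs, encoded combinatorially as rotation systems
-- (combinatorial maps): darts (half-edges) Fin d, each with a tail vertex,
-- a fixed-point-free involution rev (the opposite half-edge) and a
-- rotation permutation next (cyclic order of darts around the tail).

record RotSystem (n : ℕ) : Set where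
  field
    d        : ℕ
    tail     : Fin d → Fin n
    rev      : Fin d → Fin d
    next     : Fin d → Fin d
    prev     : Fin d → Fin d
    rev-inv  : ∀ e → rev (rev e) ≡ e
    rev-nofix : ∀ e → rev e ≢ e
    next-prev : ∀ e → next (prev e) ≡ e
    prev-next : ∀ e → prev (next e) ≡ e
    next-tail : ∀ e → tail (next e) ≡ tail e
    next-trans : ∀ e f → tail e ≡ tail f → ∃[ k ] (iter next k e ≡ f)

module _ {n : ℕ} (G : RotSystem n) where
  open RotSystem G

  head : Fin d → Fin n
  head e = tail (rev e)

  -- face permutation: traverse e = (u→v), then turn at v
  φ : Fin d → Fin d
  φ e = next (rev e)

  Adj : Fin n → Fin n → Set
  Adj u v = ∃[ e ] (tail e ≡ u × head e ≡ v)

  OrbitMin : Fin d → Set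
  OrbitMin e = ∀ (k : Fin d) → toℕ e ≤ toℕ (iter φ (toℕ k) e)

  orbitMin? : ∀ e → Relation.Nullary.Dec (OrbitMin e)
  orbitMin? e = all? (λ k → toℕ e ≤? toℕ (iter φ (toℕ k) e))

  -- number of faces = number of φ-orbits
  faceCount : ℕ
  faceCount = length (filter orbitMin? (allFin d))

  Connected : Set
  Connected = ∀ (u w : Fin n) → ∃[ m ] Σ (ℕ → Fin n) λ P →
    (P 0 ≡ u × P m ≡ w × (∀ j → j < m → Adj (P j) (P (suc j))))

  Simple : Set
  Simple = (∀ e → tail e ≢ head e)
         × (∀ e f → tail e ≡ tail f → head e ≡ head f → e ≡ f)

  -- connected, simple, genus 0 (Euler: n - d/2 + F = 2)
  IsPlane : Set
  IsPlane = Connected × Simple × (2 * n + 2 * faceCount ≡ 4 + d)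

  ShareFace : Fin n → Fin n → Set
  ShareFace u w = ∃[ e ] ∃[ k ] (tail e ≡ u × tail (iter φ k e) ≡ w)

  -- paths: P : ℕ → Fin n, considered on indices 0..m (m edges)

  IsPath : (ℕ → Fin n) → ℕ → Set
  IsPath P m = (∀ i j → i ≤ m → j ≤ m → P i ≡ P j → i ≡ j)
             × (∀ j → j < m → Adj (P j) (P (suc j)))

  -- cycles: a periodic vertex sequence of period len ≥ 3, injective on
  -- one period, consecutive vertices adjacent

  record Cycle : Set where
    field
      len    : ℕ
      len≥3  : 3 ≤ len
      vert   : ℕ → Fin n
      period : ∀ i → vert (i + len) ≡ vert i
      inj    : ∀ i j → i < len → j < len → vert i ≡ vert j → i ≡ j
      adj    : ∀ i → Adj (vert i) (vert (suc i))

  open Cycle public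

  OnCycle : Cycle → Fin n → Set
  OnCycle C v = ∃[ i ] (i < len C × vert C i ≡ v)

  EdgeOnCycle : Cycle → Fin n → Fin n → Set
  EdgeOnCycle C u v = ∃[ i ]
    ((vert C i ≡ u × vert C (suc i) ≡ v) ⊎ (vert C i ≡ v × vert C (suc i) ≡ u))

  CFree : ℕ → Set
  CFree ℓ = ∀ (C : Cycle) → ℓ ≤ len C

  -- maximal C_{<ℓ}-free plane graph: every new edge uw either creates a
  -- crossing (u, w share no face) or a cycle of length < ℓ (a u,w-path of
  -- length ≤ ℓ - 2 exists)
  MaximalFree : ℕ → Set
  MaximalFree ℓ = IsPlane × CFree ℓ ×
    (∀ u w → u ≢ w → ¬ Adj u w → ShareFace u w →
      ∃[ m ] Σ (ℕ → Fin n) λ P → (IsPath P m × P 0 ≡ u × P m ≡ w × m + 2 ≤ ℓ))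

  -- C is the boundary walk of a face (in either orientation)
  Facial : Cycle → Set
  Facial C = ∃[ e ] ((iter φ (len C) e ≡ e) ×
    ((∀ i → tail (iter φ i e) ≡ vert C i)
     ⊎ (∀ i → i ≤ len C → tail (iter φ i e) ≡ vert C (len C ∸ i))))

  Antipodal : Cycle → Fin n → Fin n → Set
  Antipodal C x y = ∃[ i ]
    ((vert C i ≡ x × vert C (i + len C / 2) ≡ y)
     ⊎ (vert C i ≡ y × vert C (i + len C / 2) ≡ x))

  -- z is a center of a segment of C with endpoints x and y: the segment
  -- is the arc vert C p, …, vert C (p + L) (0 < L < ‖C‖), and z is at
  -- position ⌊L/2⌋ or ⌈L/2⌉ along it
  CenterOfSegment : Cycle → Fin n → Fin n → Fin n → Set
  CenterOfSegment C x y z = ∃[ p ] ∃[ L ] ∃[ a ]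
    (0 < L × L < len C
     × ((vert C p ≡ x × vert C (p + L) ≡ y) ⊎ (vert C p ≡ y × vert C (p + L) ≡ x))
     × (2 * a ≡ L ⊎ 2 * a + 1 ≡ L ⊎ 2 * a ≡ L + 1)
     × vert C (p + a) ≡ z)

  SegmentPart : Cycle → (ℕ → Fin n) → ℕ → ℕ → Set
  SegmentPart C P s t = ∃[ p ]
    ((∀ j → s ≤ j → j ≤ t → P j ≡ vert C (p + (j ∸ s)))
     ⊎ (∀ j → s ≤ j → j ≤ t → P j ≡ vert C (p + (t ∸ j))))

  EarPart : Cycle → (ℕ → Fin n) → ℕ → ℕ → Set
  EarPart C P s t = s < t × OnCycle C (P s) × OnCycle C (P t)
    × (∀ j → s < j → j < t → ¬ OnCycle C (P j))
    × (∀ j → s ≤ j → j < t → ¬ EdgeOnCycle C (P j) (P (suc j)))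

  ConvexPath : Cycle → (ℕ → Fin n) → ℕ → Set
  ConvexPath C P m = SegmentPart C P 0 m
    ⊎ ∃[ a ] ∃[ b ] (a ≤ b × b ≤ m
        × SegmentPart C P 0 a × EarPart C P a b × SegmentPart C P b m)

  Lens : ℕ → Cycle → Fin n → Fin n → Set
  Lens ℓ C' x y = len C' ≤ 2 * ℓ ∸ 2 × OnCycle C' x × OnCycle C' y

  -- C' is a C-convex (x,y;ℓ)-lens: x = C' i, y = C' (i + L), and the two
  -- x,y-paths of C' are C-convex
  ConvexLens : ℕ → Cycle → Cycle → Fin n → Fin n → Set
  ConvexLens ℓ C C' x y = Lens ℓ C' x y × ∃[ i ] ∃[ L ]
    (0 < L × L < len C' × vert C' i ≡ x × vert C' (i + L) ≡ y
     × ConvexPath C (λ j → vert C' (i + j)) L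
     × ConvexPath C (λ j → vert C' (i + len C' ∸ j)) (len C' ∸ L))

-- The segment of C from x to y containing z has length L ≥ ⌊‖C‖/2⌋, since x
-- and y are antipodal, and z sits in its middle; so along C, in either
-- direction, z is at least about ‖C‖/4 steps away from both x and y. On the
-- other hand z lies on one of the two C-convex x,y-paths of C', and on such a
-- path every vertex of C outside the ear is reached from x or y along a
-- segment of C of length less than ‖C'‖ - 1 ≤ 2ℓ - 3. Comparing the two
-- bounds gives ‖C‖ < 4(2ℓ - 3).
module Submission where

open import Defs
open import Data.Nat
open import Data.Nat.Properties
open import Data.Nat.DivMod
open import Data.Nat.Tactic.RingSolver using (solve-∀)
open import Data.Fin using (Fin)
open import Data.Product using (Σ; ∃-syntax; _×_; _,_; proj₁)
open import Data.Sum as Sum using (_⊎_; inj₁; inj₂)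
open import Data.Empty using (⊥; ⊥-elim)
open import Relation.Nullary using (¬_; yes; no)
open import Relation.Binary.PropositionalEquality

∸-telescope : ∀ {s j t} → s ≤ j → j ≤ t → (j ∸ s) + (t ∸ j) ≡ t ∸ s
∸-telescope {s} {j} {t} s≤j j≤t = +-cancelˡ-≡ s _ _ (begin
  s + ((j ∸ s) + (t ∸ j)) ≡⟨ sym (+-assoc s (j ∸ s) (t ∸ j)) ⟩
  s + (j ∸ s) + (t ∸ j)   ≡⟨ cong (_+ (t ∸ j)) (m+[n∸m]≡n s≤j) ⟩
  j + (t ∸ j)             ≡⟨ m+[n∸m]≡n j≤t ⟩
  t                       ≡⟨ sym (m+[n∸m]≡n (≤-trans s≤j j≤t)) ⟩
  s + (t ∸ s)             ∎)
  where open ≡-Reasoning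

m+[n∸n]≡m : ∀ m n → m + (n ∸ n) ≡ m
m+[n∸n]≡m m n = trans (cong (m +_) (n∸n≡0 n)) (+-identityʳ m)

m+n∸[n∸o]≡m+o : ∀ m {n o} → o ≤ n → m + n ∸ (n ∸ o) ≡ m + o
m+n∸[n∸o]≡m+o m {n} {o} o≤n = trans (+-∸-assoc m (m∸n≤m n o)) (cong (m +_) (m∸[m∸n]≡n o≤n))

2*m≤1+2*n⇒m≤n : ∀ m n → 2 * m ≤ suc (2 * n) → m ≤ n
2*m≤1+2*n⇒m≤n m n le =
  ≤-pred (*-cancelˡ-< 2 m (suc n) (subst (2 * m <_) (sym (*-suc 2 n)) (s≤s le)))

4*m≤n⇒2*m≤n/2 : ∀ m {n} → 4 * m ≤ n → 2 * m ≤ n / 2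
4*m≤n⇒2*m≤n/2 m {n} le = subst (_≤ n / 2) (m*n/n≡m (2 * m) 2)
  (/-monoˡ-≤ 2 (subst (_≤ n) (double-double m) le))
  where
  double-double : ∀ m → 4 * m ≡ 2 * m * 2
  double-double = solve-∀

half-offset-bounds : ∀ a {L} → (2 * a ≡ L ⊎ 2 * a + 1 ≡ L ⊎ 2 * a ≡ L + 1)
  → L ≤ suc (2 * a) × 2 * a ≤ suc L
half-offset-bounds a {L} (inj₁ refl) = n≤1+n L , n≤1+n (2 * a)
half-offset-bounds a {L} (inj₂ (inj₁ refl)) =
  ≤-reflexive (+-comm (2 * a) 1) , ≤-trans (m≤m+n (2 * a) 1) (n≤1+n _)
half-offset-bounds a {L} (inj₂ (inj₂ 2a≡L+1)) =
  ≤-trans (m≤m+n L 1) (≤-trans (n≤1+n _) (s≤s (≤-reflexive (sym 2a≡L+1)))) ,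
  ≤-trans (≤-reflexive 2a≡L+1) (≤-reflexive (+-comm L 1))

center-offset-bounds : ∀ a {L e} → (2 * a ≡ L ⊎ 2 * a + 1 ≡ L ⊎ 2 * a ≡ L + 1)
  → 2 * suc e ≤ L → e < a × a + e < L
center-offset-bounds a {L} {e} parity 2[e+1]≤L with half-offset-bounds a parity
... | L≤1+2a , 2a≤1+L =
  2*m≤1+2*n⇒m≤n (suc e) a (≤-trans 2[e+1]≤L L≤1+2a) ,
  2*m≤1+2*n⇒m≤n (suc (a + e)) L (begin
    2 * suc (a + e)     ≡⟨ twice-sum a e ⟩
    2 * a + 2 * suc e   ≤⟨ +-mono-≤ 2a≤1+L 2[e+1]≤L ⟩
    suc L + L           ≡⟨ cong suc (+-comm L L) ⟩
    suc (L + L)         ≡⟨ cong (λ k → suc (L + k)) (sym (+-identityʳ L)) ⟩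
    suc (2 * L)         ∎)
  where
  open ≤-Reasoning
  twice-sum : ∀ a e → 2 * suc (a + e) ≡ 2 * a + 2 * suc e
  twice-sum = solve-∀

module _ {n : ℕ} {G : RotSystem n} where

  Offset : Cycle G → ℕ → Fin n → Fin n → Set
  Offset C e w z = ∃[ u ] (vert C u ≡ w × vert C (u + e) ≡ z)

  StepsApart : Cycle G → ℕ → Fin n → Fin n → Set
  StepsApart C e w z = Offset C e w z ⊎ Offset C e z w

  Ends : Cycle G → ℕ → ℕ → Fin n → Fin n → Set
  Ends C u v x y = (vert C u ≡ x × vert C v ≡ y) ⊎ (vert C u ≡ y × vert C v ≡ x)

  module _ (C : Cycle G) where

    instance
      len-nonZero : NonZero (len C)
      len-nonZero = >-nonZero (≤-trans (s≤s z≤n) (len≥3 C))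

    vert-periodic : ∀ u q → vert C (u + q * len C) ≡ vert C u
    vert-periodic u zero    = cong (vert C) (+-identityʳ u)
    vert-periodic u (suc q) = begin
      vert C (u + (len C + q * len C)) ≡⟨ cong (λ k → vert C (u + k)) (+-comm (len C) _) ⟩
      vert C (u + (q * len C + len C)) ≡⟨ cong (vert C) (sym (+-assoc u _ (len C))) ⟩
      vert C (u + q * len C + len C)   ≡⟨ period C _ ⟩
      vert C (u + q * len C)           ≡⟨ vert-periodic u q ⟩
      vert C u                         ∎
      where open ≡-Reasoning

    vert-+-mod : ∀ u e → vert C (u % len C + e) ≡ vert C (u + e)
    vert-+-mod u e = begin
      vert C (u % N + e)               ≡⟨ sym (vert-periodic _ (u / N)) ⟩
      vert C (u % N + e + u / N * N)   ≡⟨ cong (vert C) (+-assoc (u % N) e _) ⟩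
      vert C (u % N + (e + u / N * N)) ≡⟨ cong (λ k → vert C (u % N + k)) (+-comm e _) ⟩
      vert C (u % N + (u / N * N + e)) ≡⟨ cong (vert C) (sym (+-assoc (u % N) _ e)) ⟩
      vert C (u % N + u / N * N + e)   ≡⟨ cong (λ k → vert C (k + e)) (sym (m≡m%n+[m/n]*n u N)) ⟩
      vert C (u + e)                   ∎
      where
      open ≡-Reasoning
      N = len C

    vert-mod : ∀ u → vert C (u % len C) ≡ vert C u
    vert-mod u = trans (cong (vert C) (sym (+-identityʳ _)))
                       (trans (vert-+-mod u 0) (cong (vert C) (+-identityʳ u)))

    vert-onCycle : ∀ u → OnCycle G C (vert C u)
    vert-onCycle u = u % len C , m%n<n u (len C) , vert-mod u

    vert-≡⇒%-≡ : ∀ {u v} → vert C u ≡ vert C v → u % len C ≡ v % len C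
    vert-≡⇒%-≡ {u} {v} eq = inj C _ _ (m%n<n u (len C)) (m%n<n v (len C))
      (trans (vert-mod u) (trans eq (sym (vert-mod v))))

    vert-shift : ∀ {u v} e → vert C u ≡ vert C v → vert C (u + e) ≡ vert C (v + e)
    vert-shift {u} {v} e eq = begin
      vert C (u + e)          ≡⟨ sym (vert-+-mod u e) ⟩
      vert C (u % len C + e)  ≡⟨ cong (λ r → vert C (r + e)) (vert-≡⇒%-≡ eq) ⟩
      vert C (v % len C + e)  ≡⟨ vert-+-mod v e ⟩
      vert C (v + e)          ∎
      where open ≡-Reasoning

    -- Reduce u to r = u mod ‖C‖; then r + d either stays below ‖C‖ or wraps
    -- around to a smaller index, and both contradict injectivity on a period.
    vert-offset-≢ : ∀ u {d} → 0 < d → d < len C → vert C u ≢ vert C (u + d)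
    vert-offset-≢ u {d} 0<d d<N eq =
      no-return (u % len C) (m%n<n u (len C)) (trans (vert-mod u) (trans eq (sym (vert-+-mod u d))))
      where
      N = len C
      no-return : ∀ r → r < N → vert C r ≢ vert C (r + d)
      no-return r r<N r≡r+d with r + d <? N
      ... | yes r+d<N = <-irrefl (inj C r (r + d) r<N r+d<N r≡r+d) (m<m+n r 0<d)
      ... | no r+d≮N = <-irrefl (inj C s r (<-trans s<r r<N) r<N s≡r) s<r
        where
        s = r + d ∸ N
        s+N≡r+d : s + N ≡ r + d
        s+N≡r+d = m∸n+n≡m (≮⇒≥ r+d≮N)
        s<r : s < r
        s<r = +-cancelʳ-< N s r (subst (_< r + N) (sym s+N≡r+d) (+-monoʳ-< r d<N))
        s≡r : vert C s ≡ vert C r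
        s≡r = begin
          vert C s        ≡⟨ sym (period C s) ⟩
          vert C (s + N)  ≡⟨ cong (vert C) s+N≡r+d ⟩
          vert C (r + d)  ≡⟨ sym r≡r+d ⟩
          vert C r        ∎
          where open ≡-Reasoning

    vert-window-≢ : ∀ p {i j} → i < j → j < i + len C → vert C (p + i) ≢ vert C (p + j)
    vert-window-≢ p {i} {j} i<j j<i+N eq = vert-offset-≢ (p + i) (m<n⇒0<n∸m i<j)
      (m<n+o⇒m∸n<o j i j<i+N)
      (trans eq (cong (vert C) (sym p+i+[j∸i]≡p+j)))
      where
      p+i+[j∸i]≡p+j : p + i + (j ∸ i) ≡ p + j
      p+i+[j∸i]≡p+j = trans (+-assoc p i _) (cong (p +_) (m+[n∸m]≡n (<⇒≤ i<j)))

    -- Go around C as often as needed to get past i, then reduce the offset.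
    vert-rebase : ∀ i k → ∃[ j ] (j < len C × vert C (i + j) ≡ vert C k)
    vert-rebase i k = d % len C , m%n<n d (len C) , (begin
      vert C (i + d % len C)  ≡⟨ cong (vert C) (+-comm i _) ⟩
      vert C (d % len C + i)  ≡⟨ vert-+-mod d i ⟩
      vert C (d + i)          ≡⟨ cong (vert C) (+-comm d i) ⟩
      vert C (i + d)          ≡⟨ cong (vert C) (m+[n∸m]≡n i≤k+iN) ⟩
      vert C (k + i * len C)  ≡⟨ vert-periodic k i ⟩
      vert C k                ∎)
      where
      open ≡-Reasoning
      d = k + i * len C ∸ i
      i≤k+iN : i ≤ k + i * len C
      i≤k+iN = ≤-trans (m≤m*n i (len C)) (m≤n+m _ k)

    arc-same-start-≤ : ∀ {i p h L} → h ≤ len C → 0 < L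
      → vert C i ≡ vert C p → vert C (i + h) ≡ vert C (p + L) → h ≤ L
    arc-same-start-≤ {p = p} {h} {L} h≤N 0<L start end with h ≤? L
    ... | yes h≤L = h≤L
    ... | no h≰L = ⊥-elim (vert-window-≢ p (≰⇒> h≰L) (≤-<-trans h≤N (m<n+m (len C) 0<L))
                     (trans (sym end) (vert-shift h start)))

    arc-opposite-≤ : ∀ {i p h L} → 2 * h ≤ len C → 0 < L
      → vert C i ≡ vert C (p + L) → vert C (i + h) ≡ vert C p → h ≤ L
    arc-opposite-≤ {p = p} {h} {L} 2h≤N 0<L start end with h ≤? L
    ... | yes h≤L = h≤L
    ... | no h≰L = ⊥-elim (vert-offset-≢ p (≤-trans 0<L (m≤m+n L h))
                     (<-≤-trans (+-monoˡ-< h (≰⇒> h≰L)) h+h≤N)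
                     (trans (sym end) (trans (vert-shift h start) (cong (vert C) (+-assoc p L h)))))
      where
      h+h≤N : h + h ≤ len C
      h+h≤N = subst (_≤ len C) (cong (h +_) (+-identityʳ h)) 2h≤N

    -- An arc of length h ≤ ‖C‖/2 between x and y is no longer than any other
    -- arc between them: the complementary arc has length ‖C‖ - h ≥ h.
    short-arc-≤-arc : ∀ {i p h L x y} → 2 * h ≤ len C → 0 < L
      → Ends C i (i + h) x y → Ends C p (p + L) x y → h ≤ L
    short-arc-≤-arc {h = h} 2h≤N 0<L (inj₁ (ix , iy)) (inj₁ (px , py)) =
      arc-same-start-≤ (m+n≤o⇒m≤o h 2h≤N) 0<L (trans ix (sym px)) (trans iy (sym py))
    short-arc-≤-arc {h = h} 2h≤N 0<L (inj₂ (iy , ix)) (inj₂ (py , px)) =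
      arc-same-start-≤ (m+n≤o⇒m≤o h 2h≤N) 0<L (trans iy (sym py)) (trans ix (sym px))
    short-arc-≤-arc 2h≤N 0<L (inj₁ (ix , iy)) (inj₂ (py , px)) =
      arc-opposite-≤ 2h≤N 0<L (trans ix (sym px)) (trans iy (sym py))
    short-arc-≤-arc 2h≤N 0<L (inj₂ (iy , ix)) (inj₁ (px , py)) =
      arc-opposite-≤ 2h≤N 0<L (trans iy (sym py)) (trans ix (sym px))

    center-not-apart-start : ∀ p {a e} → e < a → a + e < len C
      → ¬ StepsApart C e (vert C p) (vert C (p + a))
    center-not-apart-start p {a} {e} e<a a+e<N (inj₁ (u , u≡p , u+e≡z)) =
      vert-window-≢ p e<a (<-≤-trans (≤-<-trans (m≤m+n a e) a+e<N) (m≤n+m (len C) e))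
        (trans (sym (vert-shift e u≡p)) u+e≡z)
    center-not-apart-start p {a} {e} e<a a+e<N (inj₂ (u , u≡z , u+e≡p)) =
      vert-offset-≢ p (<-≤-trans (≤-<-trans z≤n e<a) (m≤m+n a e)) a+e<N
        (trans (sym u+e≡p) (trans (vert-shift e u≡z) (cong (vert C) (+-assoc p a e))))

    center-not-apart-end : ∀ p {L a e} → e < a → a + e < L → L < len C
      → ¬ StepsApart C e (vert C (p + L)) (vert C (p + a))
    center-not-apart-end p {L} {a} {e} e<a a+e<L L<N (inj₁ (u , u≡end , u+e≡z)) =
      vert-window-≢ p (<-≤-trans (≤-<-trans (m≤m+n a e) a+e<L) (m≤m+n L e))
        (subst (L + e <_) (+-comm (len C) a) (+-mono-< L<N e<a))
        (sym (trans (cong (vert C) (sym (+-assoc p L e))) (trans (sym (vert-shift e u≡end)) u+e≡z)))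
    center-not-apart-end p {L} {a} {e} e<a a+e<L L<N (inj₂ (u , u≡z , u+e≡end)) =
      vert-window-≢ p a+e<L (<-≤-trans L<N (m≤n+m (len C) (a + e)))
        (trans (cong (vert C) (sym (+-assoc p a e))) (trans (sym (vert-shift e u≡z)) u+e≡end))

    apart-from-ends : ∀ {u v x y z e} → Ends C u v x y
      → StepsApart C e x z ⊎ StepsApart C e y z
      → StepsApart C e (vert C u) z ⊎ StepsApart C e (vert C v) z
    apart-from-ends {z = z} {e} (inj₁ (ux , vy)) = Sum.map (relabel (sym ux)) (relabel (sym vy))
      where relabel = subst (λ w → StepsApart C e w z)
    apart-from-ends {z = z} {e} (inj₂ (uy , vx)) apart =
      Sum.swap (Sum.map (relabel (sym vx)) (relabel (sym uy)) apart)
      where relabel = subst (λ w → StepsApart C e w z)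

    center-apart⇒len< : ∀ {x y z i p L a e}
      → Ends C i (i + len C / 2) x y → Ends C p (p + L) x y → 0 < L → L < len C
      → (2 * a ≡ L ⊎ 2 * a + 1 ≡ L ⊎ 2 * a ≡ L + 1) → vert C (p + a) ≡ z
      → StepsApart C e x z ⊎ StepsApart C e y z → len C < 4 * suc e
    center-apart⇒len< {x} {y} {p = p} {L} {a} {e} antipodal ends 0<L L<N parity z≡ apart
      with 4 * suc e ≤? len C
    ... | no 4[e+1]≰N = ≰⇒> 4[e+1]≰N
    ... | yes 4[e+1]≤N = ⊥-elim (not-apart (center-offset-bounds a parity 2[e+1]≤L)
          (apart-from-ends ends (subst (λ w → StepsApart C e x w ⊎ StepsApart C e y w) (sym z≡) apart)))
      where
      2[N/2]≤N : 2 * (len C / 2) ≤ len C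
      2[N/2]≤N = subst (_≤ len C) (*-comm (len C / 2) 2) (m/n*n≤m (len C) 2)
      2[e+1]≤L : 2 * suc e ≤ L
      2[e+1]≤L = ≤-trans (4*m≤n⇒2*m≤n/2 (suc e) 4[e+1]≤N)
                         (short-arc-≤-arc 2[N/2]≤N 0<L antipodal ends)
      not-apart : e < a × a + e < L
        → StepsApart C e (vert C p) (vert C (p + a)) ⊎ StepsApart C e (vert C (p + L)) (vert C (p + a))
        → ⊥
      not-apart (e<a , a+e<L) (inj₁ from-start) =
        center-not-apart-start p e<a (<-trans a+e<L L<N) from-start
      not-apart (e<a , a+e<L) (inj₂ from-end) = center-not-apart-end p e<a a+e<L L<N from-end

    segment-apart-start : ∀ {P s t j} → SegmentPart G C P s t → s ≤ j → j ≤ t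
      → StepsApart C (j ∸ s) (P s) (P j)
    segment-apart-start {s = s} {j = j} (q , inj₁ forward) s≤j j≤t =
      inj₁ (q , sym (trans (forward s ≤-refl (≤-trans s≤j j≤t)) (cong (vert C) (m+[n∸n]≡m q s))) ,
            sym (forward j s≤j j≤t))
    segment-apart-start {s = s} {t} {j} (q , inj₂ backward) s≤j j≤t =
      inj₂ (q + (t ∸ j) , sym (backward j s≤j j≤t) ,
            trans (cong (vert C) q+[t∸j]+[j∸s]≡q+[t∸s]) (sym (backward s ≤-refl (≤-trans s≤j j≤t))))
      where
      q+[t∸j]+[j∸s]≡q+[t∸s] : q + (t ∸ j) + (j ∸ s) ≡ q + (t ∸ s)
      q+[t∸j]+[j∸s]≡q+[t∸s] =
        trans (+-assoc q _ _) (cong (q +_) (trans (+-comm (t ∸ j) _) (∸-telescope s≤j j≤t)))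

    segment-apart-end : ∀ {P s t j} → SegmentPart G C P s t → s ≤ j → j ≤ t
      → StepsApart C (t ∸ j) (P t) (P j)
    segment-apart-end {s = s} {t} {j} (q , inj₁ forward) s≤j j≤t =
      inj₂ (q + (j ∸ s) , sym (forward j s≤j j≤t) ,
            trans (cong (vert C) q+[j∸s]+[t∸j]≡q+[t∸s]) (sym (forward t (≤-trans s≤j j≤t) ≤-refl)))
      where
      q+[j∸s]+[t∸j]≡q+[t∸s] : q + (j ∸ s) + (t ∸ j) ≡ q + (t ∸ s)
      q+[j∸s]+[t∸j]≡q+[t∸s] = trans (+-assoc q _ _) (cong (q +_) (∸-telescope s≤j j≤t))
    segment-apart-end {t = t} {j} (q , inj₂ backward) s≤j j≤t =
      inj₁ (q , sym (trans (backward t (≤-trans s≤j j≤t) ≤-refl) (cong (vert C) (m+[n∸n]≡m q t))) ,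
            sym (backward j s≤j j≤t))

    -- A vertex of C on a C-convex path lies on one of its two C-segments,
    -- since the interior of the ear avoids C.
    convex-path-apart : ∀ {P m j} → ConvexPath G C P m → 0 < m → j ≤ m → OnCycle G C (P j)
      → ∃[ e ] (e < m × (StepsApart C e (P 0) (P j) ⊎ StepsApart C e (P m) (P j)))
    convex-path-apart {j = zero} (inj₁ segment) 0<m _ _ =
      0 , 0<m , inj₁ (segment-apart-start segment z≤n z≤n)
    convex-path-apart {m = m} {suc j} (inj₁ segment) _ j<m _ =
      m ∸ suc j , ∸-monoʳ-< z<s j<m , inj₂ (segment-apart-end segment z≤n j<m)
    convex-path-apart {m = m} {j} (inj₂ (a , b , _ , b≤m , segment₁ , (a<b , _ , _ , off-C , _) , segment₂))
                      _ j≤m j∈C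
      with j ≤? a | j <? b
    ... | yes j≤a | _ =
      j , <-≤-trans (≤-<-trans j≤a a<b) b≤m , inj₁ (segment-apart-start segment₁ z≤n j≤a)
    ... | no j≰a | yes j<b = ⊥-elim (off-C j (≰⇒> j≰a) j<b j∈C)
    ... | no j≰a | no j≮b =
      m ∸ j , ∸-monoʳ-< (≤-<-trans z≤n (≰⇒> j≰a)) j≤m ,
      inj₂ (segment-apart-end segment₂ (≮⇒≥ j≮b) j≤m)

lens-path-through : ∀ {n} {G : RotSystem n} ℓ {C C' : Cycle G} {x y z}
  → ConvexLens G ℓ C C' x y → OnCycle G C' z
  → Σ (ℕ → Fin n) λ P → ∃[ m ] ∃[ j ]
      (ConvexPath G C P m × 0 < m × m < len C' × j ≤ m × P 0 ≡ x × P m ≡ y × P j ≡ z)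
lens-path-through _ {C' = C'} (_ , i , L , 0<L , L<M , i≡x , i+L≡y , convex , convex-reversed) (k , _ , k≡z)
  with vert-rebase C' i k
... | j , j<M , i+j≡k with j ≤? L
...   | yes j≤L = _ , L , j , convex , 0<L , L<M , j≤L ,
          trans (cong (vert C') (+-identityʳ i)) i≡x , i+L≡y , trans i+j≡k k≡z
...   | no j≰L = _ , len C' ∸ L , len C' ∸ j , convex-reversed ,
          m<n⇒0<n∸m L<M , ∸-monoʳ-< 0<L (<⇒≤ L<M) , ∸-monoʳ-≤ (len C') (<⇒≤ (≰⇒> j≰L)) ,
          trans (period C' i) i≡x ,
          trans (cong (vert C') (m+n∸[n∸o]≡m+o i (<⇒≤ L<M))) i+L≡y ,
          trans (cong (vert C') (m+n∸[n∸o]≡m+o i (<⇒≤ j<M))) (trans i+j≡k k≡z)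

lens-apart : ∀ {n} {G : RotSystem n} ℓ {C C' : Cycle G} {x y z}
  → ConvexLens G ℓ C C' x y → OnCycle G C' z → OnCycle G C z
  → ∃[ e ] (suc e < len C' × (StepsApart C e x z ⊎ StepsApart C e y z))
lens-apart {G = G} ℓ {C = C} {C'} lens z∈C' z∈C with lens-path-through ℓ {C = C} {C'} lens z∈C'
... | P , m , j , convex , 0<m , m<M , j≤m , P0≡x , Pm≡y , Pj≡z
  with convex-path-apart C convex 0<m j≤m (subst (OnCycle G C) (sym Pj≡z) z∈C)
... | e , e<m , apart = e , ≤-<-trans e<m m<M ,
        Sum.map (subst₂ (StepsApart C e) P0≡x Pj≡z) (subst₂ (StepsApart C e) Pm≡y Pj≡z) apart

lens-length-bound : ∀ ℓ {N M e} → 7 ≤ ℓ → suc e < M → M ≤ 2 * ℓ ∸ 2 → N < 4 * suc e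
  → N ≤ 8 * ℓ ∸ 13
lens-length-bound ℓ {N} {M} {e} 7≤ℓ e+1<M M≤2ℓ-2 N<4[e+1] = m+n≤o⇒m≤o∸n N (begin
  N + 13                 ≡⟨ +-comm N 13 ⟩
  12 + suc N             ≤⟨ +-monoʳ-≤ 12 N<4[e+1] ⟩
  12 + 4 * suc e         ≡⟨ rearrange e ⟩
  4 * (suc (suc e) + 2)  ≤⟨ *-monoʳ-≤ 4 (+-monoˡ-≤ 2 e+1<M) ⟩
  4 * (M + 2)            ≤⟨ *-monoʳ-≤ 4 (m≤o∸n⇒m+n≤o M 2≤2ℓ M≤2ℓ-2) ⟩
  4 * (2 * ℓ)            ≡⟨ sym (*-assoc 4 2 ℓ) ⟩
  8 * ℓ                  ∎)
  where
  open ≤-Reasoning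
  rearrange : ∀ e → 12 + 4 * suc e ≡ 4 * (suc (suc e) + 2)
  rearrange = solve-∀
  2≤2ℓ : 2 ≤ 2 * ℓ
  2≤2ℓ = ≤-trans (s≤s (s≤s z≤n)) (*-monoʳ-≤ 2 7≤ℓ)

lemma7 : (ℓ : ℕ) → 7 ≤ ℓ → (n : ℕ) (G : RotSystem n) → MaximalFree G ℓ
    → (C : Cycle G) → Facial G C → (x y z : Fin n)
    → Antipodal G C x y → CenterOfSegment G C x y z
    → (C' : Cycle G) → ConvexLens G ℓ C C' x y → OnCycle G C' z
    → len C ≤ 8 * ℓ ∸ 13
lemma7 ℓ 7≤ℓ n G _ C _ x y z (i , antipodal) (p , L , a , 0<L , L<N , ends , parity , z≡) C' lens z∈C'
  with lens-apart ℓ {C = C} {C'} lens z∈C' (subst (OnCycle G C) z≡ (vert-onCycle C (p + a)))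
... | e , e+1<M , apart = lens-length-bound ℓ 7≤ℓ e+1<M (proj₁ (proj₁ lens))
      (center-apart⇒len< C antipodal ends 0<L L<N parity z≡ apart)
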